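{- Let $n\ge 2$ be an integer. For any $\alpha>1$ there exists a weighted graph $G=(\{0,\dots,n-1\},w)$ such that $\mathrm{cdim}_\alpha(G)=\binom n2$.
   Context: A weighted graph $G=(V,w)$ has nonnegative weights on unordered pairs of distinct vertices; its edges $E$ are the pairs of positive weight. For $\emptyset\ne X\subsetneq V$, $\Delta(X)$ is the set of edges with exactly one endpoint in $X$, with weight the sum of its edge weights; $\lambda$ is the minimum cut weight. An $\alpha$-near-mincut is a cut of weight at most $\alpha\lambda$; $\mathcal{M}_\alpha(G)$ is the set of them. For $S\subseteq E$, $\chi(S)\in\{0,1\}^{|E|}$ is its characteristic vector; $\mathrm{cdim}_\alpha(G)=\dim\mathrm{span}\{\chi(S):S\in\mathcal{M}_\alpha(G)\}$.
   Formalization: The parameter α ranges over the rationals greater than 1, the edge weights are taken in ℚ, and the span defining $\mathrm{cdim}_\alpha(G)$ is taken over ℚ. -}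

module Defs where

open import Data.Nat using (ℕ; zero; suc)
open import Data.Bool using (Bool; true; false; if_then_else_; _xor_)
open import Data.Fin using (Fin; toℕ)
import Data.Fin as Fin
open import Data.Fin.Subset using (Subset; Nonempty; ∁)
open import Data.Product using (_×_; _,_; proj₁; proj₂; Σ)
open import Data.List using (List; filter; cartesianProduct; length)
import Data.List as List
open import Data.Vec using (Vec; []; _∷_; lookup; replicate; zipWith; fromList)
import Data.Vec as Vec
open import Data.Rational using (ℚ; 0ℚ; 1ℚ; _+_; _*_; _≤_; _<_)
open import Data.Rational.Properties using (_<?_)
open import Relation.Binary.PropositionalEquality using (_≡_)

-- Vertex set V = {0,…,n-1} = Fin n.  Weights w i j on pairs; only i<j is used.
Weight : ℕ → Set
Weight n = Fin n → Fin n → ℚ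

IsWeighting : ∀ {n} → Weight n → Set
IsWeighting {n} w = (∀ (i j : Fin n) → w i j ≡ w j i) × (∀ (i j : Fin n) → 0ℚ ≤ w i j)

-- unordered pairs of distinct vertices, represented as (i , j) with i < j
Pair : ℕ → Set
Pair n = Fin n × Fin n

allPairs : (n : ℕ) → List (Pair n)
allPairs n = filter (λ p → proj₁ p Fin.<? proj₂ p) (cartesianProduct (List.allFin n) (List.allFin n))

edges : ∀ {n} → Weight n → List (Pair n)
edges w = filter (λ p → 0ℚ <? w (proj₁ p) (proj₂ p)) (allPairs _)

crosses : ∀ {n} → Subset n → Pair n → Bool
crosses X (i , j) = lookup X i xor lookup X j

IsCut : ∀ {n} → Subset n → Set
IsCut X = Nonempty X × Nonempty (∁ X)

Δ : ∀ {n} → Weight n → Subset n → List (Pair n)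
Δ w X = filter (λ p → crosses X p Data.Bool.≟ true) (edges w)

sumℚ : List ℚ → ℚ
sumℚ = List.foldr _+_ 0ℚ

cutWeight : ∀ {n} → Weight n → Subset n → ℚ
cutWeight w X = sumℚ (List.map (λ p → w (proj₁ p) (proj₂ p)) (Δ w X))

-- X is an α-near-mincut: w(Δ(X)) ≤ α·λ, with λ the minimum cut weight
-- (i.e. w(Δ(X)) ≤ α · w(Δ(Y)) for every cut Y)
IsNearMincut : ∀ {n} → Weight n → ℚ → Subset n → Set
IsNearMincut {n} w α X = IsCut X × (∀ (Y : Subset n) → IsCut Y → cutWeight w X ≤ α * cutWeight w Y)

χ : ∀ {n} (w : Weight n) → Subset n → Vec ℚ (length (edges w))
χ w X = Vec.map (λ p → if crosses X p then 1ℚ else 0ℚ) (fromList (edges w))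

linComb : ∀ {k m} → Vec ℚ k → Vec (Vec ℚ m) k → Vec ℚ m
linComb {m = m} [] [] = replicate m 0ℚ
linComb (c ∷ cs) (v ∷ vs) = zipWith _+_ (Vec.map (c *_) v) (linComb cs vs)

LinIndep : ∀ {k m} → Vec (Vec ℚ m) k → Set
LinIndep {k} {m} vs = ∀ (c : Vec ℚ k) → linComb c vs ≡ replicate m 0ℚ → ∀ (i : Fin k) → lookup c i ≡ 0ℚ

-- cdim_α(G) = d : the span of {χ(S) : S ∈ M_α(G)} has dimension d, i.e. the maximum
-- size of a linearly independent family of such vectors is d.
HasCdim : ∀ {n} → Weight n → ℚ → ℕ → Set
HasCdim {n} w α d =
  Σ (Vec (Subset n) d) (λ Xs → (∀ (i : Fin d) → IsNearMincut w α (lookup Xs i)) × LinIndep (Vec.map (χ w) Xs))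
  × (∀ (k : ℕ) (Xs : Vec (Subset n) k) → (∀ (i : Fin k) → IsNearMincut w α (lookup Xs i))
       → LinIndep (Vec.map (χ w) Xs) → k Data.Nat.≤ d)

{-# OPTIONS --safe #-}
module Submission where

-- The graph is D·Cₙ + δ·Kₙ: the cycle 0, 1, …, n−1, 0 with weight D (the number of pairs) on its edges, plus
-- weight δ = α − 1 on every pair. Every cut crosses the cycle at least twice, so λ ≥ 2D, while an arc [a, b) of
-- the cycle crosses it exactly twice and so weighs at most 2D + δD ≤ α·2D: the n(n−1)/2 arcs avoiding the vertex
-- n − 1 are α-near-mincuts. Their cut vectors are independent. If Σₜ cₜ χ(t) vanishes on every pair {p, q} then,
-- by polarisation and because n − 1 lies in no arc, so does Σₜ cₜ [p ∈ t][q ∈ t], the sum of the cₜ over the arcs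
-- [a, b) with a ≤ p ≤ q < b; inclusion–exclusion in p and q isolates each single coefficient. Conversely, by
-- Gaussian elimination, an independent family of vectors in ℚ^E has at most |E| ≤ n(n−1)/2 members.

open import Defs
open import Data.Nat.Base using (ℕ)
open import Data.Rational.Base as ℚ using (ℚ)
open import Data.Rational.Solver using (module +-*-Solver)

module Sums where
  open import Algebra.Bundles using (CommutativeRing)
  open import Data.Bool.Base using (Bool; true; false; if_then_else_; _∧_)
  open import Data.Fin.Base using (Fin; zero; suc; punchIn; punchOut)
  open import Data.Fin.Properties using (_≟_; punchInᵢ≢i)
  open import Data.Nat.Base using (ℕ; zero; suc)
  open import Data.Rational.Base using (ℚ; 0ℚ; 1ℚ; _+_; _*_; _≤_; NonNegative; nonNegative)
  open import Data.Rational.Properties hiding (_≟_)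
  open import Data.Sum using (_⊎_; inj₁; inj₂; [_,_])
  open import Data.Vec.Functional using (Vector; removeAt)
  open import Data.Vec.Functional.Properties using (removeAt-punchOut)
  open import Function.Base using (_∘_)
  open import Function.Bundles using (_⇔_; mk⇔; module Equivalence)
  open import Function.Definitions using (Injective)
  open import Relation.Binary.Definitions using (DecidableEquality)
  open import Relation.Binary.PropositionalEquality hiding ([_])
  open import Relation.Nullary using (¬_)
  open import Relation.Nullary.Decidable using (Dec; yes; no; does; dec-true; dec-false; does-⇔)
  open import Algebra.Properties.Semiring.Sum (CommutativeRing.semiring +-*-commutativeRing) public
    using (sum; sum-syntax; sum-cong-≗; sum-remove; ∑-distrib-+; *-distribˡ-sum; *-distribʳ-sum;
           sum-replicate-zero)

  𝟙 : Bool → ℚ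
  𝟙 b = if b then 1ℚ else 0ℚ

  0≤𝟙 : ∀ b → 0ℚ ≤ 𝟙 b
  0≤𝟙 false = ≤-refl
  0≤𝟙 true  = nonNegative⁻¹ 1ℚ

  𝟙≤1 : ∀ b → 𝟙 b ≤ 1ℚ
  𝟙≤1 false = nonNegative⁻¹ 1ℚ
  𝟙≤1 true  = ≤-refl

  p≤p+q : ∀ {p q} → 0ℚ ≤ q → p ≤ p + q
  p≤p+q {p} 0≤q = subst (_≤ p + _) (+-identityʳ p) (+-monoʳ-≤ p 0≤q)

  0≤p*q : ∀ {p q} → 0ℚ ≤ p → 0ℚ ≤ q → 0ℚ ≤ p * q
  0≤p*q {p} {q} 0≤p 0≤q = subst (_≤ p * q) (*-zeroʳ p) (*-monoˡ-≤-nonNeg p 0≤q)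
    where
    instance
      p-nonNeg : NonNegative p
      p-nonNeg = nonNegative 0≤p

  𝟙-∧ : ∀ a b → 𝟙 (a ∧ b) ≡ 𝟙 a * 𝟙 b
  𝟙-∧ false b = sym (*-zeroˡ (𝟙 b))
  𝟙-∧ true  b = sym (*-identityˡ (𝟙 b))

  𝟙-split : ∀ {P Q R : Set} (P? : Dec P) (Q? : Dec Q) (R? : Dec R) → P ⇔ (Q ⊎ R) → (Q → ¬ R) →
    𝟙 (does P?) ≡ 𝟙 (does Q?) + 𝟙 (does R?)
  𝟙-split P? (yes q) R? P⇔Q⊎R Q⇒¬R
    rewrite dec-true P? (Equivalence.from P⇔Q⊎R (inj₁ q)) | dec-false R? (Q⇒¬R q) = refl
  𝟙-split P? (no ¬q) (yes r) P⇔Q⊎R Q⇒¬R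
    rewrite dec-true P? (Equivalence.from P⇔Q⊎R (inj₂ r)) = refl
  𝟙-split P? (no ¬q) (no ¬r) P⇔Q⊎R Q⇒¬R
    rewrite dec-false P? ([ ¬q , ¬r ] ∘ Equivalence.to P⇔Q⊎R) = refl

  𝟙-two : ∀ {U V X Y : Set} (U? : Dec U) (V? : Dec V) (X? : Dec X) (Y? : Dec Y) →
    (U → X ⊎ Y) → (V → X) → (U → V → Y) → 𝟙 (does U?) + 𝟙 (does V?) ≤ 𝟙 (does X?) + 𝟙 (does Y?)
  𝟙-two (no _)  (no _)  X? Y? _ _ _ = +-mono-≤ (0≤𝟙 (does X?)) (0≤𝟙 (does Y?))
  𝟙-two (yes u) (no _)  X? Y? U⇒X⊎Y _ _ with U⇒X⊎Y u
  ... | inj₁ x rewrite dec-true X? x = +-monoʳ-≤ 1ℚ (0≤𝟙 (does Y?))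
  ... | inj₂ y rewrite dec-true Y? y = +-monoˡ-≤ 1ℚ (0≤𝟙 (does X?))
  𝟙-two (no _)  (yes v) X? Y? _ V⇒X _ rewrite dec-true X? (V⇒X v) = +-monoʳ-≤ 1ℚ (0≤𝟙 (does Y?))
  𝟙-two (yes u) (yes v) X? Y? _ V⇒X U⇒V⇒Y rewrite dec-true X? (V⇒X v) | dec-true Y? (U⇒V⇒Y u v) = ≤-refl

  private
    variable
      k : ℕ
      f g : Vector ℚ k

  ∑-mono-≤ : (∀ i → f i ≤ g i) → sum f ≤ sum g
  ∑-mono-≤ {zero}  f≤g = ≤-refl
  ∑-mono-≤ {suc k} f≤g = +-mono-≤ (f≤g zero) (∑-mono-≤ (f≤g ∘ suc))

  0≤∑ : (∀ i → 0ℚ ≤ f i) → 0ℚ ≤ sum f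
  0≤∑ {k} {f} 0≤f = subst (_≤ sum f) (sum-replicate-zero k) (∑-mono-≤ 0≤f)

  term≤∑ : (∀ i → 0ℚ ≤ f i) → ∀ s → f s ≤ sum f
  term≤∑ {suc k} {f} 0≤f s = begin
    f s                          ≡⟨ +-identityʳ (f s) ⟨
    f s + 0ℚ                     ≤⟨ +-monoʳ-≤ (f s) (0≤∑ (0≤f ∘ punchIn s)) ⟩
    f s + sum (removeAt f s)     ≡⟨ sum-remove f ⟨
    sum f                        ∎
    where open ≤-Reasoning

  two-terms≤∑ : (∀ i → 0ℚ ≤ f i) → ∀ {s t} → s ≢ t → f s + f t ≤ sum f
  two-terms≤∑ {suc k} {f} 0≤f {s} {t} s≢t = begin
    f s + f t                    ≡⟨ cong (f s +_) (removeAt-punchOut f s≢t) ⟨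
    f s + removeAt f s (punchOut s≢t)
                                 ≤⟨ +-monoʳ-≤ (f s) (term≤∑ (0≤f ∘ punchIn s) (punchOut s≢t)) ⟩
    f s + sum (removeAt f s)     ≡⟨ sum-remove f ⟨
    sum f                        ∎
    where open ≤-Reasoning

  ∑-zero : (∀ i → f i ≡ 0ℚ) → sum f ≡ 0ℚ
  ∑-zero {k} f≡0 = trans (sum-cong-≗ f≡0) (sum-replicate-zero k)

  ∑-indicator : ∀ (f : Vector ℚ k) s → ∑[ i < k ] (f i * 𝟙 (does (i ≟ s))) ≡ f s
  ∑-indicator {suc k} f s = begin
    ∑[ i < _ ] (f i * 𝟙 (does (i ≟ s)))
      ≡⟨ sum-remove (λ i → f i * 𝟙 (does (i ≟ s))) ⟩
    f s * 𝟙 (does (s ≟ s)) + ∑[ j < _ ] (f (punchIn s j) * 𝟙 (does (punchIn s j ≟ s)))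
      ≡⟨ cong₂ _+_ (cong (λ b → f s * 𝟙 b) (dec-true (s ≟ s) refl))
                   (∑-zero off-diagonal) ⟩
    f s * 1ℚ + 0ℚ
      ≡⟨ trans (+-identityʳ _) (*-identityʳ (f s)) ⟩
    f s ∎
    where
    open ≡-Reasoning
    off-diagonal : ∀ j → f (punchIn s j) * 𝟙 (does (punchIn s j ≟ s)) ≡ 0ℚ
    off-diagonal j = trans (cong (λ b → f (punchIn s j) * 𝟙 b) (dec-false (punchIn s j ≟ s) (punchInᵢ≢i s j)))
                           (*-zeroʳ (f (punchIn s j)))

  ∑-indicator-injective : ∀ {A : Set} (f : Vector ℚ k) (h : Fin k → A) → Injective _≡_ _≡_ h →
    (_≟ᴬ_ : DecidableEquality A) → ∀ s {x} → h s ≡ x → ∑[ i < k ] (f i * 𝟙 (does (h i ≟ᴬ x))) ≡ f s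
  ∑-indicator-injective f h h-injective _≟ᴬ_ s {x} h[s]≡x =
    trans (sum-cong-≗ (λ i → cong (λ b → f i * 𝟙 b) (does-⇔ (h≡x⇔≡ i) (h i ≟ᴬ x) (i ≟ s))))
          (∑-indicator f s)
    where
    h≡x⇔≡ : ∀ i → (h i ≡ x) ⇔ (i ≡ s)
    h≡x⇔≡ i = mk⇔ (λ h[i]≡x → h-injective (trans h[i]≡x (sym h[s]≡x))) (λ { refl → h[s]≡x })

module LinearAlgebra where
  open Sums
  open +-*-Solver using (solve; _:+_; _:*_; _:-_; :-_; _:=_; con)
  open import Data.Fin.Base using (Fin; zero; suc; punchIn)
  open import Data.Fin.Properties using (any?)
  open import Data.Nat.Base using (zero; suc; _≤_; _<_; s<s)
  open import Data.Nat.Properties using (_≤?_; ≰⇒>; m<n⇒m<1+n)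
  open import Data.Product using (∃-syntax; _×_; _,_)
  open import Data.Rational.Base using (ℚ; 0ℚ; 1ℚ; _+_; _*_; -_; _-_; 1/_; NonZero; ≢-nonZero)
  open import Data.Rational.Properties
    using (_≟_; 1≢0; *-zeroʳ; *-inverseˡ; *-assoc; *-identityʳ; +-inverseʳ; +-identityˡ)
  open import Data.Vec.Base as Vec using (Vec; []; _∷_; lookup; tabulate; replicate)
  open import Data.Vec.Functional using (Vector; insertAt)
  open import Data.Vec.Functional.Properties using (insertAt-lookup; insertAt-punchIn)
  open import Data.Vec.Properties using (lookup-zipWith; lookup-map; lookup-replicate;
    lookup∘tabulate; tabulate∘lookup; tabulate-cong)
  open import Function.Base using (_∘_)
  open import Relation.Binary.PropositionalEquality hiding ([_])
  open import Relation.Nullary using (yes; no; ¬?; contradiction)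

  IsLinearRelation : ∀ {k m} → (Fin k → Vector ℚ m) → Vector ℚ k → Set
  IsLinearRelation {k} A c = ∀ l → ∑[ i < k ] (c i * A i l) ≡ 0ℚ

  Dependent : ∀ {k m} → (Fin k → Vector ℚ m) → Set
  Dependent {k} A = ∃[ c ] (∃[ i ] c i ≢ 0ℚ) × IsLinearRelation A c

  relation-zero-column : ∀ {k m} {A : Fin k → Vector ℚ (suc m)} {c} → (∀ i → A i zero ≡ 0ℚ) →
    IsLinearRelation (λ i → A i ∘ suc) c → IsLinearRelation A c
  relation-zero-column {c = c} zero-column relation zero =
    ∑-zero (λ i → trans (cong (c i *_) (zero-column i)) (*-zeroʳ (c i)))
  relation-zero-column zero-column relation (suc l) = relation l

  module Elimination {k m} (A : Fin (suc k) → Vector ℚ (suc m)) (j : Fin (suc k))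
                     (pivot≢0 : A j zero ≢ 0ℚ) where
    instance
      pivot-nonZero : NonZero (A j zero)
      pivot-nonZero = ≢-nonZero pivot≢0

    ratio : Fin k → ℚ
    ratio i = A (punchIn j i) zero * 1/ A j zero

    cleared : Fin k → Vector ℚ (suc m)
    cleared i l = A (punchIn j i) l - ratio i * A j l

    cleared-zero : ∀ i → cleared i zero ≡ 0ℚ
    cleared-zero i = trans (cong (λ x → A (punchIn j i) zero - x) ratio*pivot) (+-inverseʳ (A (punchIn j i) zero))
      where
      ratio*pivot : ratio i * A j zero ≡ A (punchIn j i) zero
      ratio*pivot = trans (*-assoc (A (punchIn j i) zero) (1/ A j zero) (A j zero))
                          (trans (cong (A (punchIn j i) zero *_) (*-inverseˡ (A j zero)))
                                 (*-identityʳ (A (punchIn j i) zero)))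

    lift : Dependent (λ i → cleared i ∘ suc) → Dependent A
    lift (d , (i , dᵢ≢0) , relation) = c , (punchIn j i , cᵢ≢0) , relation′
      where
      S : ℚ
      S = ∑[ i < k ] (d i * ratio i)
      c : Vector ℚ (suc k)
      c = insertAt d j (- S)

      cᵢ≢0 : c (punchIn j i) ≢ 0ℚ
      cᵢ≢0 = dᵢ≢0 ∘ trans (sym (insertAt-punchIn d j (- S) i))

      other-rows : ∀ l → ∑[ i < k ] (d i * A (punchIn j i) l) ≡ S * A j l
      other-rows l = begin
        ∑[ i < k ] (d i * A (punchIn j i) l)
          ≡⟨ sum-cong-≗ (λ i → split (d i) (A (punchIn j i) l) (ratio i) (A j l)) ⟩
        ∑[ i < k ] (d i * cleared i l + d i * ratio i * A j l)
          ≡⟨ ∑-distrib-+ (λ i → d i * cleared i l) (λ i → d i * ratio i * A j l) ⟩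
        ∑[ i < k ] (d i * cleared i l) + ∑[ i < k ] (d i * ratio i * A j l)
          ≡⟨ cong₂ _+_ (relation-zero-column {A = cleared} {d} cleared-zero relation l)
                       (sym (*-distribʳ-sum (A j l) (λ i → d i * ratio i))) ⟩
        0ℚ + S * A j l
          ≡⟨ +-identityˡ _ ⟩
        S * A j l ∎
        where
        open ≡-Reasoning
        split : ∀ d a r p → d * a ≡ d * (a - r * p) + d * r * p
        split = solve 4 (λ d a r p → d :* a := d :* (a :- r :* p) :+ d :* r :* p) refl

      relation′ : IsLinearRelation A c
      relation′ l = begin
        ∑[ i < suc k ] (c i * A i l)
          ≡⟨ sum-remove (λ i → c i * A i l) ⟩
        c j * A j l + ∑[ i < k ] (c (punchIn j i) * A (punchIn j i) l)
          ≡⟨ cong₂ _+_ (cong (_* A j l) (insertAt-lookup d j (- S)))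
                       (sum-cong-≗ (λ i → cong (_* A (punchIn j i) l) (insertAt-punchIn d j (- S) i))) ⟩
        - S * A j l + ∑[ i < k ] (d i * A (punchIn j i) l)
          ≡⟨ cong (- S * A j l +_) (other-rows l) ⟩
        - S * A j l + S * A j l
          ≡⟨ cancel S (A j l) ⟩
        0ℚ ∎
        where
        open ≡-Reasoning
        cancel : ∀ s a → - s * a + s * a ≡ 0ℚ
        cancel = solve 2 (λ s a → (:- s) :* a :+ s :* a := con 0ℚ) refl

  <⇒dependent : ∀ {m k} → m < k → (A : Fin k → Vector ℚ m) → Dependent A
  <⇒dependent {zero} {suc k} _ A = (λ _ → 1ℚ) , (zero , 1≢0) , λ ()
  <⇒dependent {suc m} {suc k} (s<s m<k) A with any? (λ i → ¬? (A i zero ≟ 0ℚ))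
  ... | yes (j , pivot≢0) = Elimination.lift A j pivot≢0 (<⇒dependent m<k _)
  ... | no no-pivot = extend (<⇒dependent (m<n⇒m<1+n m<k) (λ i → A i ∘ suc))
    where
    zero-column : ∀ i → A i zero ≡ 0ℚ
    zero-column i with A i zero ≟ 0ℚ
    ... | yes Aᵢ≡0 = Aᵢ≡0
    ... | no  Aᵢ≢0 = contradiction (i , Aᵢ≢0) no-pivot
    extend : Dependent (λ i → A i ∘ suc) → Dependent A
    extend (c , nontrivial , relation) = c , nontrivial , relation-zero-column {A = A} {c} zero-column relation

  lookup-linComb : ∀ {k m} (c : Vec ℚ k) (vs : Vec (Vec ℚ m) k) l →
    lookup (linComb c vs) l ≡ ∑[ i < k ] (lookup c i * lookup (lookup vs i) l)
  lookup-linComb []       []       l = lookup-replicate l 0ℚ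
  lookup-linComb (c ∷ cs) (v ∷ vs) l = trans (lookup-zipWith _+_ l (Vec.map (c *_) v) (linComb cs vs))
    (cong₂ _+_ (lookup-map l (c *_) v) (lookup-linComb cs vs l))

  LinIndep⇒≤ : ∀ {k m} (vs : Vec (Vec ℚ m) k) → LinIndep vs → k ≤ m
  LinIndep⇒≤ {k} {m} vs independent with k ≤? m
  ... | yes k≤m = k≤m
  ... | no  k≰m with <⇒dependent (≰⇒> k≰m) (λ i → lookup (lookup vs i))
  ...   | c , (i , cᵢ≢0) , relation =
    contradiction (trans (sym (lookup∘tabulate c i)) (independent (tabulate c) combination-zero i)) cᵢ≢0
    where
    combination-zero : linComb (tabulate c) vs ≡ replicate m 0ℚ
    combination-zero = begin
      linComb (tabulate c) vs                       ≡⟨ tabulate∘lookup _ ⟨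
      tabulate (lookup (linComb (tabulate c) vs))   ≡⟨ tabulate-cong coordinate-zero ⟩
      tabulate (lookup (replicate m 0ℚ))            ≡⟨ tabulate∘lookup _ ⟩
      replicate m 0ℚ                                ∎
      where
      open ≡-Reasoning
      coordinate-zero : ∀ l → lookup (linComb (tabulate c) vs) l ≡ lookup (replicate m 0ℚ) l
      coordinate-zero l = begin
        lookup (linComb (tabulate c) vs) l
          ≡⟨ lookup-linComb (tabulate c) vs l ⟩
        ∑[ i < k ] (lookup (tabulate c) i * lookup (lookup vs i) l)
          ≡⟨ sum-cong-≗ (λ i → cong (_* lookup (lookup vs i) l) (lookup∘tabulate c i)) ⟩
        ∑[ i < k ] (c i * lookup (lookup vs i) l)
          ≡⟨ relation l ⟩
        0ℚ
          ≡⟨ lookup-replicate l 0ℚ ⟨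
        lookup (replicate m 0ℚ) l ∎

module Intervals where
  open Sums
  open +-*-Solver using (solve; _:+_; _:*_; _:=_)
  open import Data.Bool.Base using (Bool; true; false; _∧_; _xor_)
  open import Data.Bool.Properties using (∧-zeroʳ; ∧-idem; xor-identityʳ)
  open import Data.Fin.Base using (Fin)
  open import Data.Nat.Base using (zero; suc; _≤_; _<_; s≤s; s≤s⁻¹)
  open import Data.Nat.Properties
    using (_≟_; _≤?_; _<?_; ≤-refl; ≤-trans; <-trans; ≤-<-trans; <⇒≤; ≤⇒≯; ≮⇒≥; <⇒≢; >⇒≢; ≤∧≢⇒<; n<1+n;
           m≤n⇒m≤1+n; m<n⇒m<1+n; m≤n⇒m<n∨m≡n; m<1+n⇒m<n∨m≡n)
  open import Data.Product using (_×_; _,_; proj₁; proj₂; uncurry)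
  open import Data.Product.Properties using (,-injective)
  open import Data.Rational.Base using (0ℚ; ½; -½; _+_; _*_)
  open import Data.Rational.Properties using (*-zeroˡ; *-zeroʳ; *-distribˡ-+; +-identityʳ)
  open import Data.Sum as Sum using (_⊎_; inj₁; inj₂; [_,_])
  open import Function.Base using (_∘_)
  open import Function.Bundles using (mk⇔)
  open import Function.Definitions using (Injective)
  open import Relation.Binary.Definitions using (DecidableEquality)
  open import Relation.Binary.PropositionalEquality hiding ([_])
  open import Relation.Nullary using (contradiction)
  open import Relation.Nullary.Decidable using (yes; no; does; dec-false; does-⇔; map′; _×-dec_)

  _≟₂_ : DecidableEquality (ℕ × ℕ)
  (x , y) ≟₂ (a , b) = map′ (uncurry (cong₂ _,_)) ,-injective (x ≟ a ×-dec y ≟ b)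

  _∈ᴵ_ : ℕ → ℕ × ℕ → Bool
  p ∈ᴵ (a , b) = does (a ≤? p) ∧ does (p <? b)

  ProperInterval : ℕ → ℕ × ℕ → Set
  ProperInterval r (a , b) = a < b × b ≤ r

  ∉ᴵ-beyond : ∀ {p} t → proj₂ t ≤ p → p ∈ᴵ t ≡ false
  ∉ᴵ-beyond {p} (a , b) b≤p = trans (cong (does (a ≤? p) ∧_) (dec-false (p <? b) (≤⇒≯ b≤p))) (∧-zeroʳ _)

  ∈ᴵ-both : ∀ {p q} t → p ≤ q → (p ∈ᴵ t ∧ q ∈ᴵ t) ≡ (does (proj₁ t ≤? p) ∧ does (q <? proj₂ t))
  ∈ᴵ-both {p} {q} (a , b) p≤q = does-⇔ (mk⇔ outer inner)
    ((a ≤? p ×-dec p <? b) ×-dec (a ≤? q ×-dec q <? b)) (a ≤? p ×-dec q <? b)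
    where
    outer : (a ≤ p × p < b) × (a ≤ q × q < b) → a ≤ p × q < b
    outer ((a≤p , _) , (_ , q<b)) = a≤p , q<b
    inner : a ≤ p × q < b → (a ≤ p × p < b) × (a ≤ q × q < b)
    inner (a≤p , q<b) = (a≤p , ≤-<-trans p≤q q<b) , (≤-trans a≤p p≤q , q<b)

  ∈ᴵ-boundary : ∀ {p} t → p ∈ᴵ t ≢ suc p ∈ᴵ t → suc p ≡ proj₁ t ⊎ suc p ≡ proj₂ t
  ∈ᴵ-boundary {p} (a , b) changes with suc p ≟ a | suc p ≟ b
  ... | yes 1+p≡a | _         = inj₁ 1+p≡a
  ... | no _      | yes 1+p≡b = inj₂ 1+p≡b
  ... | no 1+p≢a  | no 1+p≢b  =
    contradiction (does-⇔ (mk⇔ outer inner) (a ≤? p ×-dec p <? b) (a ≤? suc p ×-dec suc p <? b)) changes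
    where
    outer : a ≤ p × p < b → a ≤ suc p × suc p < b
    outer (a≤p , p<b) = m≤n⇒m≤1+n a≤p , ≤∧≢⇒< p<b 1+p≢b
    inner : a ≤ suc p × suc p < b → a ≤ p × p < b
    inner (a≤1+p , 1+p<b) = s≤s⁻¹ (≤∧≢⇒< a≤1+p (1+p≢a ∘ sym)) , <-trans (n<1+n p) 1+p<b

  -- For p ≤ q, corner (1 + p) q t = 𝟙 (p ∈ᴵ t ∧ q ∈ᴵ t); the shift supplies the case p = −1 that
  -- inclusion–exclusion needs for the arcs starting at 0.
  corner : ℕ → ℕ → ℕ × ℕ → ℚ
  corner u v (a , b) = 𝟙 (does (a <? u)) * 𝟙 (does (v <? b))

  private
    polarization : ∀ x y → 𝟙 (x ∧ y) ≡ ½ * 𝟙 x + (½ * 𝟙 y + -½ * 𝟙 (x xor y))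
    polarization false false = refl
    polarization false true  = refl
    polarization true  false = refl
    polarization true  true  = refl

  module _ {k r : ℕ} (I : Fin k → ℕ × ℕ) (I-injective : Injective _≡_ _≡_ I)
           (I-proper : ∀ i → ProperInterval r (I i)) (c : Fin k → ℚ)
           (balanced : ∀ {p q} → p < q → q ≤ r → ∑[ i < k ] (c i * 𝟙 (p ∈ᴵ I i xor q ∈ᴵ I i)) ≡ 0ℚ)
           where

    private
      Φ : (ℕ × ℕ → ℚ) → ℚ
      Φ f = ∑[ i < k ] (c i * f (I i))

      Φ-cong : ∀ f g → (∀ i → f (I i) ≡ g (I i)) → Φ f ≡ Φ g
      Φ-cong f g f≡g = sum-cong-≗ (λ i → cong (c i *_) (f≡g i))

      Φ-zero : ∀ f → (∀ i → f (I i) ≡ 0ℚ) → Φ f ≡ 0ℚ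
      Φ-zero f f≡0 = ∑-zero (λ i → trans (cong (c i *_) (f≡0 i)) (*-zeroʳ (c i)))

      Φ-+ : ∀ f g → Φ (λ t → f t + g t) ≡ Φ f + Φ g
      Φ-+ f g = trans (sum-cong-≗ (λ i → *-distribˡ-+ (c i) (f (I i)) (g (I i))))
                      (∑-distrib-+ (λ i → c i * f (I i)) (λ i → c i * g (I i)))

      Φ-* : ∀ x f → Φ (λ t → x * f t) ≡ x * Φ f
      Φ-* x f = trans (sum-cong-≗ (λ i → swap (c i) x (f (I i)))) (sym (*-distribˡ-sum x (λ i → c i * f (I i))))
        where
        swap : ∀ c x y → c * (x * y) ≡ x * (c * y)
        swap = solve 3 (λ c x y → c :* (x :* y) := x :* (c :* y)) refl

      member both crossing : ℕ → ℕ → ℕ × ℕ → ℚ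
      member   p _ t = 𝟙 (p ∈ᴵ t)
      both     p q t = 𝟙 (p ∈ᴵ t ∧ q ∈ᴵ t)
      crossing p q t = 𝟙 (p ∈ᴵ t xor q ∈ᴵ t)

      member-vanishes : ∀ {p} → p < r → Φ (member p p) ≡ 0ℚ
      member-vanishes {p} p<r = trans (Φ-cong (member p p) (crossing p r) r-outside) (balanced p<r ≤-refl)
        where
        r-outside : ∀ i → 𝟙 (p ∈ᴵ I i) ≡ 𝟙 (p ∈ᴵ I i xor r ∈ᴵ I i)
        r-outside i = cong 𝟙 (trans (sym (xor-identityʳ _))
                                    (cong (p ∈ᴵ I i xor_) (sym (∉ᴵ-beyond (I i) (proj₂ (I-proper i))))))

      both-vanish : ∀ {p q} → p ≤ q → Φ (both p q) ≡ 0ℚ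
      both-vanish {p} {q} p≤q with q <? r
      ... | no q≮r = Φ-zero (both p q) (λ i → cong 𝟙 (trans (cong (p ∈ᴵ I i ∧_) (q-outside i)) (∧-zeroʳ _)))
        where
        q-outside : ∀ i → q ∈ᴵ I i ≡ false
        q-outside i = ∉ᴵ-beyond (I i) (≤-trans (proj₂ (I-proper i)) (≮⇒≥ q≮r))
      ... | yes q<r with m≤n⇒m<n∨m≡n p≤q
      ...   | inj₂ refl = trans (Φ-cong (both p p) (member p p) (λ i → cong 𝟙 (∧-idem (p ∈ᴵ I i))))
                                (member-vanishes q<r)
      ...   | inj₁ p<q = begin
        Φ (both p q)
          ≡⟨ Φ-cong (both p q) (λ t → ½ * member p p t + (½ * member q q t + -½ * crossing p q t))
                    (λ i → polarization (p ∈ᴵ I i) (q ∈ᴵ I i)) ⟩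
        Φ (λ t → ½ * member p p t + (½ * member q q t + -½ * crossing p q t))
          ≡⟨ Φ-+ (λ t → ½ * member p p t) (λ t → ½ * member q q t + -½ * crossing p q t) ⟩
        Φ (λ t → ½ * member p p t) + Φ (λ t → ½ * member q q t + -½ * crossing p q t)
          ≡⟨ cong (Φ (λ t → ½ * member p p t) +_)
                  (Φ-+ (λ t → ½ * member q q t) (λ t → -½ * crossing p q t)) ⟩
        Φ (λ t → ½ * member p p t) + (Φ (λ t → ½ * member q q t) + Φ (λ t → -½ * crossing p q t))
          ≡⟨ cong₂ _+_ (Φ-* ½ (member p p)) (cong₂ _+_ (Φ-* ½ (member q q)) (Φ-* -½ (crossing p q))) ⟩
        ½ * Φ (member p p) + (½ * Φ (member q q) + -½ * Φ (crossing p q))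
          ≡⟨ cong₂ (λ x y → ½ * x + (½ * y + -½ * Φ (crossing p q)))
                   (member-vanishes (<-trans p<q q<r)) (member-vanishes q<r) ⟩
        ½ * 0ℚ + (½ * 0ℚ + -½ * Φ (crossing p q))
          ≡⟨ cong (λ x → ½ * 0ℚ + (½ * 0ℚ + -½ * x)) (balanced p<q (<⇒≤ q<r)) ⟩
        0ℚ ∎
        where open ≡-Reasoning

      corner-vanishes : ∀ {u v} → u ≤ suc v → Φ (corner u v) ≡ 0ℚ
      corner-vanishes {zero}  {v} _     = Φ-zero (corner 0 v) (λ i → *-zeroˡ (𝟙 (does (v <? proj₂ (I i)))))
      corner-vanishes {suc p} {v} sp≤sv =
        trans (Φ-cong (corner (suc p) v) (both p v) (λ i → corner-both (I i))) (both-vanish (s≤s⁻¹ sp≤sv))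
        where
        corner-both : ∀ t → corner (suc p) v t ≡ 𝟙 (p ∈ᴵ t ∧ v ∈ᴵ t)
        corner-both (a , b) = begin
          𝟙 (does (a <? suc p)) * 𝟙 (does (v <? b))   ≡⟨ 𝟙-∧ (does (a <? suc p)) (does (v <? b)) ⟨
          𝟙 (does (a <? suc p) ∧ does (v <? b))       ≡⟨ cong (λ x → 𝟙 (x ∧ does (v <? b)))
                                                             (does-⇔ (mk⇔ s≤s⁻¹ s≤s) (a <? suc p) (a ≤? p)) ⟩
          𝟙 (does (a ≤? p) ∧ does (v <? b))           ≡⟨ cong 𝟙 (∈ᴵ-both (a , b) (s≤s⁻¹ sp≤sv)) ⟨
          𝟙 (p ∈ᴵ (a , b) ∧ v ∈ᴵ (a , b))             ∎
          where open ≡-Reasoning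

      inclusion-exclusion : ∀ a v t →
        𝟙 (does (t ≟₂ (a , suc v))) + corner a v t + corner (suc a) (suc v) t ≡
        corner (suc a) v t + corner a (suc v) t
      inclusion-exclusion a v (x , y) = begin
        𝟙 (does (x ≟ a) ∧ does (y ≟ suc v)) + 𝟙 (does (x <? a)) * 𝟙 (does (v <? y))
          + 𝟙 (does (x <? suc a)) * 𝟙 (does (suc v <? y))
          ≡⟨ cong₂ (λ e x<sa → e + 𝟙 (does (x <? a)) * 𝟙 (does (v <? y)) + x<sa * 𝟙 (does (suc v <? y)))
                   (𝟙-∧ (does (x ≟ a)) (does (y ≟ suc v))) x<suc-a ⟩
        E * F + X * 𝟙 (does (v <? y)) + (X + E) * Y
          ≡⟨ cong (λ v<y → E * F + X * v<y + (X + E) * Y) v<y ⟩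
        E * F + X * (Y + F) + (X + E) * Y
          ≡⟨ expand E F X Y ⟩
        (X + E) * (Y + F) + X * Y
          ≡⟨ cong₂ (λ x<sa v<y → x<sa * v<y + X * Y) x<suc-a v<y ⟨
        𝟙 (does (x <? suc a)) * 𝟙 (does (v <? y)) + 𝟙 (does (x <? a)) * 𝟙 (does (suc v <? y)) ∎
        where
        open ≡-Reasoning
        X E Y F : ℚ
        X = 𝟙 (does (x <? a))
        E = 𝟙 (does (x ≟ a))
        Y = 𝟙 (does (suc v <? y))
        F = 𝟙 (does (y ≟ suc v))
        x<suc-a : 𝟙 (does (x <? suc a)) ≡ X + E
        x<suc-a = 𝟙-split (x <? suc a) (x <? a) (x ≟ a)
          (mk⇔ m<1+n⇒m<n∨m≡n [ m<n⇒m<1+n , (λ { refl → n<1+n x }) ]) <⇒≢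
        v<y : 𝟙 (does (v <? y)) ≡ Y + F
        v<y = 𝟙-split (v <? y) (suc v <? y) (y ≟ suc v)
          (mk⇔ (Sum.map₂ sym ∘ m≤n⇒m<n∨m≡n) [ <-trans (n<1+n v) , (λ { refl → n<1+n v }) ]) (>⇒≢)
        expand : ∀ e f x y → e * f + x * (y + f) + (x + e) * y ≡ (x + e) * (y + f) + x * y
        expand = solve 4 (λ e f x y → e :* f :+ x :* (y :+ f) :+ (x :+ e) :* y := (x :+ e) :* (y :+ f) :+ x :* y) refl

    interval-crossings-independent : ∀ s → c s ≡ 0ℚ
    interval-crossings-independent s with I s in I[s] | I-proper s
    ... | (a , suc v) | s≤s a≤v , _ = begin
      c s
        ≡⟨ trans (+-identityʳ _) (+-identityʳ _) ⟨
      c s + 0ℚ + 0ℚ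
        ≡⟨ cong₂ (λ x y → x + y + 0ℚ) coefficient (corner-vanishes (m≤n⇒m≤1+n a≤v)) ⟨
      Φ δₛ + Φ (corner a v) + 0ℚ
        ≡⟨ cong (Φ δₛ + Φ (corner a v) +_) (corner-vanishes (m≤n⇒m≤1+n (s≤s a≤v))) ⟨
      Φ δₛ + Φ (corner a v) + Φ (corner (suc a) (suc v))
        ≡⟨ cong (_+ Φ (corner (suc a) (suc v))) (Φ-+ δₛ (corner a v)) ⟨
      Φ (λ t → δₛ t + corner a v t) + Φ (corner (suc a) (suc v))
        ≡⟨ Φ-+ (λ t → δₛ t + corner a v t) (corner (suc a) (suc v)) ⟨
      Φ (λ t → δₛ t + corner a v t + corner (suc a) (suc v) t)
        ≡⟨ Φ-cong (λ t → δₛ t + corner a v t + corner (suc a) (suc v) t)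
                  (λ t → corner (suc a) v t + corner a (suc v) t) (λ i → inclusion-exclusion a v (I i)) ⟩
      Φ (λ t → corner (suc a) v t + corner a (suc v) t)
        ≡⟨ Φ-+ (corner (suc a) v) (corner a (suc v)) ⟩
      Φ (corner (suc a) v) + Φ (corner a (suc v))
        ≡⟨ cong₂ _+_ (corner-vanishes (s≤s a≤v)) (corner-vanishes (m≤n⇒m≤1+n (m≤n⇒m≤1+n a≤v))) ⟩
      0ℚ ∎
      where
      open ≡-Reasoning
      δₛ : ℕ × ℕ → ℚ
      δₛ t = 𝟙 (does (t ≟₂ (a , suc v)))
      coefficient : Φ δₛ ≡ c s
      coefficient = ∑-indicator-injective c I I-injective _≟₂_ s I[s]

module Pairs where
  open import Data.Fin.Base as Fin using (Fin; zero; suc; toℕ; fromℕ<)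
  open import Data.Fin.Properties using (suc-injective; toℕ-injective; toℕ-fromℕ<; toℕ<n)
  open import Data.List.Base as List using (List; _++_; map; allFin; length; lookup)
  open import Data.List.Membership.Propositional using (_∈_)
  open import Data.List.Membership.Propositional.Properties
  open import Data.List.Membership.Propositional.Properties.WithK using (unique∧set⇒bag)
  open import Data.List.Properties using (length-++; length-map; length-tabulate)
  open import Data.List.Relation.Binary.BagAndSetEquality using (∼bag⇒↭)
  open import Data.List.Relation.Binary.Permutation.Propositional.Properties using (↭-length)
  open import Data.List.Relation.Unary.All as All using ()
  open import Data.List.Relation.Unary.AllPairs using ([]; _∷_)
  open import Data.List.Relation.Unary.Any using (index)
  open import Data.List.Relation.Unary.Any.Properties using (lookup-index)
  open import Data.List.Relation.Unary.Unique.Propositional using (Unique)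
  import Data.List.Relation.Unary.Unique.Propositional.Properties as Unique
  open import Data.Nat.Base using (ℕ; zero; suc; _+_; _<_; z<s; s<s)
  open import Data.Nat.Combinatorics using (_C_; nC1≡n; nCk+nC[k+1]≡[n+1]C[k+1])
  open import Data.Nat.Properties using (<-trans)
  open import Data.Product as Product using (_×_; _,_; proj₁; proj₂; ∃-syntax)
  open import Data.Sum using (inj₁; inj₂)
  open import Function.Base using (_∘_)
  open import Function.Bundles using (mk⇔)
  open import Function.Definitions using (Injective)
  open import Relation.Binary.PropositionalEquality
  open import Relation.Nullary using (¬_; contradiction)

  lookup-injective : ∀ {A : Set} {xs : List A} → Unique xs → Injective _≡_ _≡_ (lookup xs)
  lookup-injective (_ ∷ _)      {zero}  {zero}  _  = refl
  lookup-injective (x∉xs ∷ _)   {zero}  {suc j} eq = contradiction eq (All.lookup x∉xs (∈-lookup j))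
  lookup-injective (x∉xs ∷ _)   {suc i} {zero}  eq = contradiction (sym eq) (All.lookup x∉xs (∈-lookup i))
  lookup-injective (_ ∷ unique) {suc i} {suc j} eq = cong suc (lookup-injective unique eq)

  toℕ² : ∀ {n} → Pair n → ℕ × ℕ
  toℕ² (i , j) = toℕ i , toℕ j

  toℕ²-injective : ∀ {n} → Injective _≡_ _≡_ (toℕ² {n})
  toℕ²-injective {x = _ , _} {_ , _} eq = cong₂ _,_ (toℕ-injective (cong proj₁ eq)) (toℕ-injective (cong proj₂ eq))

  Sorted : ∀ {n} → Pair n → Set
  Sorted (i , j) = i Fin.< j

  ∈-allPairs⁺ : ∀ {n} {e : Pair n} → Sorted e → e ∈ allPairs n
  ∈-allPairs⁺ {n} {i , j} = ∈-filter⁺ _ (∈-cartesianProduct⁺ (∈-allFin i) (∈-allFin j))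

  ∈-allPairs⁻ : ∀ {n} {e : Pair n} → e ∈ allPairs n → Sorted e
  ∈-allPairs⁻ {n} = proj₂ ∘ ∈-filter⁻ _ {xs = List.cartesianProduct (allFin n) (allFin n)}

  allPairs-unique : ∀ n → Unique (allPairs n)
  allPairs-unique n = Unique.filter⁺ _ (Unique.cartesianProduct⁺ (Unique.allFin⁺ n) (Unique.allFin⁺ n))

  sortedPairs : ∀ n → List (Pair n)
  sortedPairs zero    = List.[]
  sortedPairs (suc n) = map (zero ,_) (map suc (allFin n)) ++ map (Product.map suc suc) (sortedPairs n)

  length-sortedPairs : ∀ n → length (sortedPairs n) ≡ n C 2
  length-sortedPairs zero    = refl
  length-sortedPairs (suc n) = begin
    length (map (zero ,_) (map suc (allFin n)) ++ map (Product.map suc suc) (sortedPairs n))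
      ≡⟨ length-++ (map (zero ,_) (map suc (allFin n))) ⟩
    length (map (zero ,_) (map suc (allFin n))) + length (map (Product.map suc suc) (sortedPairs n))
      ≡⟨ cong₂ _+_ (trans (length-map (zero ,_) (map suc (allFin n)))
                          (trans (length-map suc (allFin n)) (length-tabulate (λ i → i))))
                   (trans (length-map _ (sortedPairs n)) (length-sortedPairs n)) ⟩
    n + n C 2
      ≡⟨ cong (_+ n C 2) (nC1≡n n) ⟨
    n C 1 + n C 2
      ≡⟨ nCk+nC[k+1]≡[n+1]C[k+1] n 1 ⟩
    suc n C 2 ∎
    where open ≡-Reasoning

  ∈-sortedPairs⁺ : ∀ {n} {e : Pair n} → Sorted e → e ∈ sortedPairs n
  ∈-sortedPairs⁺ {suc n} {zero , suc j} _ = ∈-++⁺ˡ (∈-map⁺ (zero ,_) (∈-map⁺ suc (∈-allFin j)))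
  ∈-sortedPairs⁺ {suc n} {suc i , suc j} (s<s i<j) =
    ∈-++⁺ʳ (map (zero ,_) (map suc (allFin n))) (∈-map⁺ (Product.map suc suc) (∈-sortedPairs⁺ i<j))

  ∈-sortedPairs⁻ : ∀ {n} {e : Pair n} → e ∈ sortedPairs n → Sorted e
  ∈-sortedPairs⁻ {suc n} e∈ with ∈-++⁻ (map (zero ,_) (map suc (allFin n))) e∈
  ... | inj₁ e∈first with ∈-map⁻ (zero ,_) e∈first
  ...   | _ , j∈ , refl with ∈-map⁻ suc j∈
  ...     | _ , _ , refl = z<s
  ∈-sortedPairs⁻ {suc n} e∈ | inj₂ e∈rest with ∈-map⁻ (Product.map suc suc) e∈rest
  ... | _ , e′∈ , refl = s<s (∈-sortedPairs⁻ e′∈)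

  sortedPairs-unique : ∀ n → Unique (sortedPairs n)
  sortedPairs-unique zero    = []
  sortedPairs-unique (suc n) = Unique.++⁺
    (Unique.map⁺ (cong proj₂) (Unique.map⁺ suc-injective (Unique.allFin⁺ n)))
    (Unique.map⁺ (λ { refl → refl }) (sortedPairs-unique n))
    (λ (first , rest) → zero≢suc first rest)
    where
    zero≢suc : ∀ {e} → e ∈ map (zero ,_) (map suc (allFin n)) → ¬ e ∈ map (Product.map suc suc) (sortedPairs n)
    zero≢suc e∈first e∈rest with ∈-map⁻ (zero ,_) e∈first | ∈-map⁻ (Product.map suc suc) e∈rest
    ... | _ , _ , refl | _ , _ , ()

  length-allPairs : ∀ n → length (allPairs n) ≡ n C 2
  length-allPairs n = trans (↭-length (∼bag⇒↭ (unique∧set⇒bag (allPairs-unique n) (sortedPairs-unique n)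
                        (mk⇔ (∈-sortedPairs⁺ ∘ ∈-allPairs⁻) (∈-allPairs⁺ ∘ ∈-sortedPairs⁻)))))
                            (length-sortedPairs n)

  module Enumeration (n : ℕ) where
    M : ℕ
    M = length (allPairs n)

    pair : Fin M → Pair n
    pair = lookup (allPairs n)

    ends : Fin M → ℕ × ℕ
    ends = toℕ² ∘ pair

    ends-injective : Injective _≡_ _≡_ ends
    ends-injective = lookup-injective (allPairs-unique n) ∘ toℕ²-injective

    ends-sorted : ∀ s → proj₁ (ends s) < proj₂ (ends s)
    ends-sorted s = ∈-allPairs⁻ (∈-lookup s)

    ends-bounded : ∀ s → proj₂ (ends s) < n
    ends-bounded s = toℕ<n (proj₂ (pair s))

    ends-surjective : ∀ {p q} → p < q → q < n → ∃[ s ] ends s ≡ (p , q)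
    ends-surjective {p} {q} p<q q<n = index e∈ , trans (cong toℕ² (sym (lookup-index e∈)))
                                                        (cong₂ _,_ (toℕ-fromℕ< _) (toℕ-fromℕ< q<n))
      where
      e : Pair n
      e = fromℕ< (<-trans p<q q<n) , fromℕ< q<n
      e∈ : e ∈ allPairs n
      e∈ = ∈-allPairs⁺ (subst₂ _<_ (sym (toℕ-fromℕ< _)) (sym (toℕ-fromℕ< q<n)) p<q)

module Cuts where
  open Sums
  open Pairs
  open import Data.Bool.Base using (Bool; true; false; _xor_)
  open import Data.Bool.Properties using () renaming (_≟_ to _≟ᴮ_)
  open import Data.Fin.Base using (Fin; zero; suc; toℕ)
  open import Data.Fin.Subset using (Subset)
  open import Data.List.Base as List using (List; []; _∷_; filter)
  open import Data.List.Membership.Propositional using (_∈_)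
  open import Data.List.Properties using (filter-all)
  open import Data.List.Relation.Unary.All using (universal)
  open import Data.List.Relation.Unary.Any using (index)
  open import Data.List.Relation.Unary.Any.Properties using (lookup-index)
  open import Data.Nat.Base using (ℕ; zero; suc; _≤_; _<_; s≤s⁻¹)
  open import Data.Nat.Properties using (n≤0⇒n≡0; m≤n⇒m<n∨m≡n; n<1+n; m<n⇒m<1+n)
  open import Data.Product using (_×_; _,_; proj₁; proj₂; ∃-syntax)
  open import Data.Rational.Base as ℚ using (ℚ; 0ℚ; _+_; _*_)
  open import Data.Rational.Properties using (_<?_; *-identityˡ; *-zeroˡ; +-identityˡ)
  open import Data.Sum using (inj₁; inj₂)
  open import Data.Vec.Base as Vec using (Vec; []; _∷_; lookup; fromList; replicate)
  open import Data.Vec.Properties using (lookup-map; lookup-replicate)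
  open import Function.Base using (_∘_)
  open import Level using (0ℓ)
  open import Relation.Binary.PropositionalEquality
  open import Relation.Nullary using (yes; no; contradiction)
  open import Relation.Nullary.Decidable using (does)
  open import Relation.Unary using (Pred; Decidable)
  open LinearAlgebra using (lookup-linComb)

  at : ∀ {n} → Subset n → ℕ → Bool
  at []      _       = false
  at (x ∷ _) zero    = x
  at (_ ∷ X) (suc p) = at X p

  lookup-at : ∀ {n} (X : Subset n) i → lookup X i ≡ at X (toℕ i)
  lookup-at (_ ∷ _) zero    = refl
  lookup-at (_ ∷ X) (suc i) = lookup-at X i

  crosses-at : ∀ {n} (X : Subset n) e → crosses X e ≡ at X (toℕ (proj₁ e)) xor at X (toℕ (proj₂ e))
  crosses-at X (i , j) = cong₂ _xor_ (lookup-at X i) (lookup-at X j)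

  change-between : ∀ (g : ℕ → Bool) {a b} → a ≤ b → g a ≢ g b → ∃[ k ] a ≤ k × k < b × g k ≢ g (suc k)
  change-between g {a} {zero}  a≤0   ga≢g0 = contradiction (cong g (n≤0⇒n≡0 a≤0)) ga≢g0
  change-between g {a} {suc b} a≤1+b ga≢g1+b with m≤n⇒m<n∨m≡n a≤1+b
  ... | inj₂ refl = contradiction refl ga≢g1+b
  ... | inj₁ a<1+b with g b ≟ᴮ g (suc b)
  ...   | no  gb≢g1+b = b , s≤s⁻¹ a<1+b , n<1+n b , gb≢g1+b
  ...   | yes gb≡g1+b with change-between g (s≤s⁻¹ a<1+b) (λ ga≡gb → ga≢g1+b (trans ga≡gb gb≡g1+b))
  ...     | k , a≤k , k<b , gk≢g1+k = k , a≤k , m<n⇒m<1+n k<b , gk≢g1+k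

  sumℚ-filter : ∀ {A : Set} {P : Pred A 0ℓ} (P? : Decidable P) (f : A → ℚ) xs →
    sumℚ (List.map f (filter P? xs)) ≡ sumℚ (List.map (λ x → 𝟙 (does (P? x)) * f x) xs)
  sumℚ-filter P? f []       = refl
  sumℚ-filter P? f (x ∷ xs) with does (P? x)
  ... | true  = cong₂ _+_ (sym (*-identityˡ (f x))) (sumℚ-filter P? f xs)
  ... | false = trans (sumℚ-filter P? f xs) (sym (trans (cong (_+ _) (*-zeroˡ (f x))) (+-identityˡ _)))

  sumℚ-lookup : ∀ {A : Set} (f : A → ℚ) (xs : List A) →
    sumℚ (List.map f xs) ≡ ∑[ s < List.length xs ] f (List.lookup xs s)
  sumℚ-lookup f []       = refl
  sumℚ-lookup f (x ∷ xs) = cong (f x +_) (sumℚ-lookup f xs)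

  cutWeight-∑ : ∀ {n} (w : Weight n) → (∀ i j → 0ℚ ℚ.< w i j) → ∀ X → let open Enumeration n in
    cutWeight w X ≡ ∑[ s < M ] (𝟙 (crosses X (pair s)) * w (proj₁ (pair s)) (proj₂ (pair s)))
  cutWeight-∑ {n} w w>0 X = begin
    cutWeight w X
      ≡⟨ sumℚ-filter (λ e → crosses X e ≟ᴮ true) w′ (edges w) ⟩
    sumℚ (List.map (λ e → 𝟙 (does (crosses X e ≟ᴮ true)) * w′ e) (edges w))
      ≡⟨ cong (λ es → sumℚ (List.map (λ e → 𝟙 (does (crosses X e ≟ᴮ true)) * w′ e) es))
              (filter-all (λ e → 0ℚ <? w′ e) (universal (λ (i , j) → w>0 i j) (allPairs n))) ⟩
    sumℚ (List.map (λ e → 𝟙 (does (crosses X e ≟ᴮ true)) * w′ e) (allPairs n))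
      ≡⟨ sumℚ-lookup _ (allPairs n) ⟩
    ∑[ s < M ] (𝟙 (does (crosses X (pair s) ≟ᴮ true)) * w′ (pair s))
      ≡⟨ sum-cong-≗ (λ s → cong (λ b → 𝟙 b * w′ (pair s)) (does-≟true (crosses X (pair s)))) ⟩
    ∑[ s < M ] (𝟙 (crosses X (pair s)) * w′ (pair s)) ∎
    where
    open ≡-Reasoning
    open Enumeration n
    w′ : Pair n → ℚ
    w′ (i , j) = w i j
    does-≟true : ∀ b → does (b ≟ᴮ true) ≡ b
    does-≟true false = refl
    does-≟true true  = refl

  lookup-fromList : ∀ {A : Set} (xs : List A) i → lookup (fromList xs) i ≡ List.lookup xs i
  lookup-fromList (x ∷ xs) zero    = refl
  lookup-fromList (x ∷ xs) (suc i) = lookup-fromList xs i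

  relation-at-edge : ∀ {n k} (w : Weight n) (Xs : Vec (Subset n) k) (c : Vec ℚ k) →
    linComb c (Vec.map (χ w) Xs) ≡ replicate _ 0ℚ → ∀ {e} → e ∈ edges w →
    ∑[ i < k ] (lookup c i * 𝟙 (crosses (lookup Xs i) e)) ≡ 0ℚ
  relation-at-edge {k = k} w Xs c combination-zero {e} e∈E = begin
    ∑[ i < k ] (lookup c i * 𝟙 (crosses (lookup Xs i) e))
      ≡⟨ sum-cong-≗ (λ i → cong (lookup c i *_) (coordinate i)) ⟨
    ∑[ i < k ] (lookup c i * lookup (lookup (Vec.map (χ w) Xs) i) l)
      ≡⟨ lookup-linComb c (Vec.map (χ w) Xs) l ⟨
    lookup (linComb c (Vec.map (χ w) Xs)) l
      ≡⟨ cong (λ v → lookup v l) combination-zero ⟩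
    lookup (replicate _ 0ℚ) l
      ≡⟨ lookup-replicate l 0ℚ ⟩
    0ℚ ∎
    where
    open ≡-Reasoning
    l : Fin (List.length (edges w))
    l = index e∈E
    coordinate : ∀ i → lookup (lookup (Vec.map (χ w) Xs) i) l ≡ 𝟙 (crosses (lookup Xs i) e)
    coordinate i = begin
      lookup (lookup (Vec.map (χ w) Xs) i) l
        ≡⟨ cong (λ v → lookup v l) (lookup-map i (χ w) Xs) ⟩
      lookup (χ w (lookup Xs i)) l
        ≡⟨ lookup-map l _ (fromList (edges w)) ⟩
      𝟙 (crosses (lookup Xs i) (lookup (fromList (edges w)) l))
        ≡⟨ cong (𝟙 ∘ crosses (lookup Xs i)) (lookup-fromList (edges w) l) ⟩
      𝟙 (crosses (lookup Xs i) (List.lookup (edges w) l))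
        ≡⟨ cong (𝟙 ∘ crosses (lookup Xs i)) (lookup-index e∈E) ⟨
      𝟙 (crosses (lookup Xs i) e)                                  ∎

module Distance where
  open import Data.Nat.Base using (zero; suc; _≤_; _<_; ∣_-_∣; s<s)
  open import Data.Nat.Properties using (∣m-n∣≤m⊔n; m≤n⇒m⊔n≡n; <⇒≤; ≤-trans; 1+n≰n)
  open import Data.Product using (_×_; _,_)
  open import Relation.Binary.PropositionalEquality
  open import Relation.Nullary using (contradiction)

  ∣n-1+n∣≡1 : ∀ n → ∣ n - suc n ∣ ≡ 1
  ∣n-1+n∣≡1 zero    = refl
  ∣n-1+n∣≡1 (suc n) = ∣n-1+n∣≡1 n

  ∣m-n∣≡1⇒n≡1+m : ∀ {m n} → m < n → ∣ m - n ∣ ≡ 1 → n ≡ suc m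
  ∣m-n∣≡1⇒n≡1+m {zero}  {n}     _         n≡1 = n≡1
  ∣m-n∣≡1⇒n≡1+m {suc m} {suc n} (s<s m<n) d≡1 = cong suc (∣m-n∣≡1⇒n≡1+m m<n d≡1)

  ∣m-n∣≡r⇒m≡0∧n≡r : ∀ {m n r} → m < n → n ≤ r → ∣ m - n ∣ ≡ r → m ≡ 0 × n ≡ r
  ∣m-n∣≡r⇒m≡0∧n≡r {zero}  _         _   n≡r = refl , n≡r
  ∣m-n∣≡r⇒m≡0∧n≡r {suc m} {suc n} (s<s m<n) 1+n≤r d≡r = contradiction (≤-trans 1+n≤r r≤n) 1+n≰n
    where
    r≤n : _ ≤ n
    r≤n = subst (_≤ n) d≡r (subst (∣ m - n ∣ ≤_) (m≤n⇒m⊔n≡n (<⇒≤ m<n)) (∣m-n∣≤m⊔n m n))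

module CycleGraph (r : ℕ) (δ : ℚ) (0<δ : ℚ.0ℚ ℚ.< δ) where
  open Sums
  open +-*-Solver using (solve; _:+_; _:*_; _:=_; con)
  open Intervals
  open Pairs
  open Cuts
  open Distance
  open import Data.Bool.Base using (Bool; true; false; not; _∧_; _xor_; T)
  open import Data.Bool.Properties using (T-∧; xor-same; xor-identityʳ) renaming (_≟_ to _≟ᴮ_)
  open import Data.Fin.Base using (Fin; zero; suc; toℕ; fromℕ; fromℕ<)
  open import Data.Fin.Properties using (toℕ-fromℕ; toℕ-fromℕ<; toℕ<n)
  open import Data.Fin.Subset using (Subset; ∁)
  open import Data.List.Membership.Propositional using (_∈_)
  open import Data.List.Membership.Propositional.Properties using (∈-filter⁺; ∈-lookup)
  open import Data.List.Properties using (length-filter)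
  open import Data.Nat.Base as ℕ using (ℕ; zero; suc; ∣_-_∣; s≤s; s≤s⁻¹; z≤n)
  open import Data.Nat.Properties as ℕ using (∣-∣-comm)
  open import Data.Product using (_×_; _,_; proj₁; proj₂; ∃-syntax)
  open import Data.Rational.Base using (0ℚ; 1ℚ; _+_; _*_; _≤_; _<_; NonNegative; nonNegative)
  open import Data.Rational.Properties
  open import Data.Sum as Sum using (_⊎_; inj₁; inj₂)
  open import Data.Vec.Base as Vec using (Vec; tabulate; lookup)
  open import Data.Vec.Properties using (lookup∘tabulate; lookup-map; lookup⇒[]=; []=⇒lookup)
  open import Function.Base using (_∘_)
  open import Function.Bundles using (module Equivalence)
  open import Relation.Binary.PropositionalEquality
  open import Relation.Nullary using (contradiction)
  open import Relation.Nullary.Decidable using (Dec; yes; no; does; dec-true; T?; _×-dec_)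
  open LinearAlgebra using (LinIndep⇒≤)
  open Pairs.Enumeration (suc r)

  D : ℚ
  D = ∑[ s < M ] 1ℚ

  0≤D : 0ℚ ≤ D
  0≤D = 0≤∑ {M} {λ _ → 1ℚ} (λ _ → 0≤𝟙 true)

  -- On the cycle 0, 1, …, r, 0 the vertices p and q are adjacent iff |p − q| is 1 or r. For n = 2 both hold: the
  -- doubled edge keeps every cut of weight at least 2D.
  cycleMultiplicity : ℕ × ℕ → ℚ
  cycleMultiplicity (p , q) = 𝟙 (does (∣ p - q ∣ ℕ.≟ 1)) + 𝟙 (does (∣ p - q ∣ ℕ.≟ r))

  0≤cycleMultiplicity : ∀ e → 0ℚ ≤ cycleMultiplicity e
  0≤cycleMultiplicity (p , q) =
    +-mono-≤ (0≤𝟙 (does (∣ p - q ∣ ℕ.≟ 1))) (0≤𝟙 (does (∣ p - q ∣ ℕ.≟ r)))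

  weight : Weight (suc r)
  weight i j = D * cycleMultiplicity (toℕ i , toℕ j) + δ

  weight-positive : ∀ i j → 0ℚ < weight i j
  weight-positive i j = +-mono-≤-< (0≤p*q 0≤D (0≤cycleMultiplicity (toℕ i , toℕ j))) 0<δ

  positive? : (e : Pair (suc r)) → Dec (0ℚ < weight (proj₁ e) (proj₂ e))
  positive? e = 0ℚ <? weight (proj₁ e) (proj₂ e)

  weight-isWeighting : IsWeighting weight
  weight-isWeighting = symmetric , λ i j → <⇒≤ (weight-positive i j)
    where
    symmetric : ∀ i j → weight i j ≡ weight j i
    symmetric i j rewrite ∣-∣-comm (toℕ i) (toℕ j) = refl

  separates : (ℕ → Bool) → ℕ × ℕ → Bool
  separates g (p , q) = g p xor g q

  crossSum : (ℕ → Bool) → (ℕ × ℕ → ℚ) → ℚ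
  crossSum g f = ∑[ s < M ] (𝟙 (separates g (ends s)) * f (ends s))

  cutWeight≡crossSums : ∀ X g → (∀ e → crosses X e ≡ separates g (toℕ² e)) →
    cutWeight weight X ≡ D * crossSum g cycleMultiplicity + δ * crossSum g (λ _ → 1ℚ)
  cutWeight≡crossSums X g crosses≡ = begin
    cutWeight weight X
      ≡⟨ cutWeight-∑ weight weight-positive X ⟩
    ∑[ s < M ] (𝟙 (crosses X (pair s)) * (D * cycleMultiplicity (ends s) + δ))
      ≡⟨ sum-cong-≗ (λ s → trans (cong (λ b → 𝟙 b * _) (crosses≡ (pair s)))
                                 (distribute (𝟙 (separates g (ends s))) (cycleMultiplicity (ends s)) D δ)) ⟩
    ∑[ s < M ] (D * (𝟙 (separates g (ends s)) * cycleMultiplicity (ends s)) + δ * (𝟙 (separates g (ends s)) * 1ℚ))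
      ≡⟨ ∑-distrib-+ (λ s → D * (𝟙 (separates g (ends s)) * cycleMultiplicity (ends s)))
                     (λ s → δ * (𝟙 (separates g (ends s)) * 1ℚ)) ⟩
    ∑[ s < M ] (D * (𝟙 (separates g (ends s)) * cycleMultiplicity (ends s)))
      + ∑[ s < M ] (δ * (𝟙 (separates g (ends s)) * 1ℚ))
      ≡⟨ cong₂ _+_ (*-distribˡ-sum D (λ s → 𝟙 (separates g (ends s)) * cycleMultiplicity (ends s)))
                   (*-distribˡ-sum δ (λ s → 𝟙 (separates g (ends s)) * 1ℚ)) ⟨
    D * crossSum g cycleMultiplicity + δ * crossSum g (λ _ → 1ℚ) ∎
    where
    open ≡-Reasoning
    distribute : ∀ x m d e → x * (d * m + e) ≡ d * (x * m) + e * (x * 1ℚ)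
    distribute = solve 4 (λ x m d e → x :* (d :* m :+ e) := d :* (x :* m) :+ e :* (x :* con 1ℚ)) refl

  arc : ℕ × ℕ → Subset (suc r)
  arc t = tabulate (λ i → toℕ i ∈ᴵ t)

  lookup-arc : ∀ t i → lookup (arc t) i ≡ toℕ i ∈ᴵ t
  lookup-arc t = lookup∘tabulate (λ i → toℕ i ∈ᴵ t)

  crosses-arc : ∀ t e → crosses (arc t) e ≡ separates (_∈ᴵ t) (toℕ² e)
  crosses-arc t (i , j) = cong₂ _xor_ (lookup-arc t i) (lookup-arc t j)

  arc-isCut : ∀ {t} → ProperInterval r t → IsCut (arc t)
  arc-isCut {a , b} (a<b , b≤r) =
    (fromℕ< a<n , lookup⇒[]= _ (arc (a , b)) a∈arc) , (fromℕ r , lookup⇒[]= _ (∁ (arc (a , b))) r∉arc)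
    where
    a<n : a ℕ.< suc r
    a<n = ℕ.<-≤-trans a<b (ℕ.m≤n⇒m≤1+n b≤r)
    a∈arc : lookup (arc (a , b)) (fromℕ< a<n) ≡ true
    a∈arc = trans (lookup-arc (a , b) (fromℕ< a<n))
                  (subst (λ p → p ∈ᴵ (a , b) ≡ true) (sym (toℕ-fromℕ< a<n)) a∈[a,b[)
      where
      a∈[a,b[ : a ∈ᴵ (a , b) ≡ true
      a∈[a,b[ rewrite dec-true (a ℕ.≤? a) ℕ.≤-refl | dec-true (a ℕ.<? b) a<b = refl
    r∉arc : lookup (∁ (arc (a , b))) (fromℕ r) ≡ true
    r∉arc = trans (lookup-map (fromℕ r) not (arc (a , b)))
                  (cong not (trans (lookup-arc (a , b) (fromℕ r))
                                   (subst (λ p → p ∈ᴵ (a , b) ≡ false) (sym (toℕ-fromℕ r))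
                                          (∉ᴵ-beyond (a , b) b≤r))))

  multiplicity-split : ∀ x p q → 𝟙 x * cycleMultiplicity (p , q) ≡
    𝟙 (x ∧ does (∣ p - q ∣ ℕ.≟ 1)) + 𝟙 (x ∧ does (∣ p - q ∣ ℕ.≟ r))
  multiplicity-split x p q = trans (*-distribˡ-+ (𝟙 x) _ _)
    (sym (cong₂ _+_ (𝟙-∧ x (does (∣ p - q ∣ ℕ.≟ 1))) (𝟙-∧ x (does (∣ p - q ∣ ℕ.≟ r)))))

  -- The cycle edge entering the vertex a; the arc [a, b) crosses exactly the cycle edges entry a and entry b.
  entry : ℕ → ℕ × ℕ
  entry zero    = 0 , r
  entry (suc a) = a , suc a

  entry-proper : 0 ℕ.< r → ∀ {a} → a ℕ.≤ r → ProperInterval r (entry a)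
  entry-proper 0<r {zero}  _   = 0<r , ℕ.≤-refl
  entry-proper _   {suc a} a≤r = ℕ.n<1+n a , a≤r

  ∑-indicator-ends : ∀ {x} → ProperInterval r x → ∑[ s < M ] 𝟙 (does (ends s ≟₂ x)) ≡ 1ℚ
  ∑-indicator-ends (p<q , q≤r) with ends-surjective p<q (s≤s q≤r)
  ... | s₀ , ends≡ = trans (sum-cong-≗ (λ s → sym (*-identityˡ (𝟙 (does (ends s ≟₂ _))))))
                           (∑-indicator-injective (λ _ → 1ℚ) ends ends-injective _≟₂_ s₀ ends≡)

  private
    T-xor⇒≢ : ∀ {x y} → T (x xor y) → x ≢ y
    T-xor⇒≢ {x} x⊕y refl = subst T (xor-same x) x⊕y

    wrap-crossed⇒a≡0 : ∀ {a b} → b ℕ.≤ r → T (separates (_∈ᴵ (a , b)) (0 , r)) → a ≡ 0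
    wrap-crossed⇒a≡0 {a} {b} b≤r crossing =
      ℕ.n≤0⇒n≡0 (ℕ.≤ᵇ⇒≤ a 0 (proj₁ (Equivalence.to T-∧ 0∈[a,b[)))
      where
      0∈[a,b[ : T (0 ∈ᴵ (a , b))
      0∈[a,b[ = subst T (trans (cong (0 ∈ᴵ (a , b) xor_) (∉ᴵ-beyond (a , b) b≤r)) (xor-identityʳ _)) crossing

    crossed-step-edge : ∀ {a b p q} → p ℕ.< q → T (separates (_∈ᴵ (a , b)) (p , q)) → ∣ p - q ∣ ≡ 1 →
      (p , q) ≡ entry a ⊎ (p , q) ≡ entry b
    crossed-step-edge {a} {b} p<q crosses d≡1 with ∣m-n∣≡1⇒n≡1+m p<q d≡1
    ... | refl = Sum.map (cong entry) (cong entry) (∈ᴵ-boundary (a , b) (T-xor⇒≢ crosses))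

    crossed-wrap-edge : ∀ {a b p q} → b ℕ.≤ r → p ℕ.< q → q ℕ.≤ r →
      T (separates (_∈ᴵ (a , b)) (p , q)) → ∣ p - q ∣ ≡ r → (p , q) ≡ entry a
    crossed-wrap-edge {a} {b} b≤r p<q q≤r crosses d≡r with ∣m-n∣≡r⇒m≡0∧n≡r p<q q≤r d≡r
    ... | refl , refl with wrap-crossed⇒a≡0 {a} {b} b≤r crosses
    ...   | refl = refl

    crossed-double-edge : ∀ {a b p q} → b ℕ.≤ r → p ℕ.< q → q ℕ.≤ r →
      T (separates (_∈ᴵ (a , b)) (p , q)) → ∣ p - q ∣ ≡ 1 → ∣ p - q ∣ ≡ r → (p , q) ≡ entry b
    crossed-double-edge {a} {b} b≤r p<q q≤r crosses d≡1 d≡r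
      with ∣m-n∣≡1⇒n≡1+m p<q d≡1 | ∣m-n∣≡r⇒m≡0∧n≡r p<q q≤r d≡r
    ... | refl | refl , refl with ∈ᴵ-boundary (a , b) (T-xor⇒≢ crosses)
    ...   | inj₂ 1≡b = cong entry 1≡b
    ...   | inj₁ 1≡a = contradiction (trans 1≡a (wrap-crossed⇒a≡0 {a} {b} b≤r crosses)) λ ()

  arc-crossing-bound : ∀ {a b p q} → ProperInterval r (a , b) → p ℕ.< q → q ℕ.≤ r →
    𝟙 (separates (_∈ᴵ (a , b)) (p , q)) * cycleMultiplicity (p , q) ≤
    𝟙 (does ((p , q) ≟₂ entry a)) + 𝟙 (does ((p , q) ≟₂ entry b))
  arc-crossing-bound {a} {b} {p} {q} (a<b , b≤r) p<q q≤r =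
    subst (_≤ 𝟙 (does ((p , q) ≟₂ entry a)) + 𝟙 (does ((p , q) ≟₂ entry b)))
          (sym (multiplicity-split crossing p q))
      (𝟙-two (T? crossing ×-dec (∣ p - q ∣ ℕ.≟ 1)) (T? crossing ×-dec (∣ p - q ∣ ℕ.≟ r))
             ((p , q) ≟₂ entry a) ((p , q) ≟₂ entry b)
             (λ (crosses , d≡1) → crossed-step-edge {a} {b} p<q crosses d≡1)
             (λ (crosses , d≡r) → crossed-wrap-edge {a} {b} b≤r p<q q≤r crosses d≡r)
             (λ (crosses , d≡1) (_ , d≡r) → crossed-double-edge {a} {b} b≤r p<q q≤r crosses d≡1 d≡r))
    where
    crossing : Bool
    crossing = separates (_∈ᴵ (a , b)) (p , q)

  ends-proper : ∀ s → ProperInterval r (ends s)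
  ends-proper s = ends-sorted s , s≤s⁻¹ (ends-bounded s)

  crossSum-arc≤2 : ∀ {t} → ProperInterval r t → crossSum (_∈ᴵ t) cycleMultiplicity ≤ 1ℚ + 1ℚ
  crossSum-arc≤2 {a , b} proper@(a<b , b≤r) = begin
    crossSum (_∈ᴵ (a , b)) cycleMultiplicity
      ≤⟨ ∑-mono-≤ (λ s → arc-crossing-bound proper (ends-sorted s) (proj₂ (ends-proper s))) ⟩
    ∑[ s < M ] (𝟙 (does (ends s ≟₂ entry a)) + 𝟙 (does (ends s ≟₂ entry b)))
      ≡⟨ ∑-distrib-+ (λ s → 𝟙 (does (ends s ≟₂ entry a))) (λ s → 𝟙 (does (ends s ≟₂ entry b))) ⟩
    ∑[ s < M ] 𝟙 (does (ends s ≟₂ entry a)) + ∑[ s < M ] 𝟙 (does (ends s ≟₂ entry b))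
      ≡⟨ cong₂ _+_ (∑-indicator-ends (entry-proper 0<r (ℕ.<⇒≤ (ℕ.<-≤-trans a<b b≤r))))
                   (∑-indicator-ends (entry-proper 0<r b≤r)) ⟩
    1ℚ + 1ℚ ∎
    where
    open ≤-Reasoning
    0<r : 0 ℕ.< r
    0<r = ℕ.<-≤-trans (ℕ.≤-<-trans z≤n a<b) b≤r

  crossSum-ones≤D : ∀ g → crossSum g (λ _ → 1ℚ) ≤ D
  crossSum-ones≤D g = ∑-mono-≤ (λ s → subst (_≤ 1ℚ) (sym (*-identityʳ _)) (𝟙≤1 (separates g (ends s))))

  0≤crossSum-ones : ∀ g → 0ℚ ≤ crossSum g (λ _ → 1ℚ)
  0≤crossSum-ones g = 0≤∑ (λ s → subst (0ℚ ≤_) (sym (*-identityʳ _)) (0≤𝟙 (separates g (ends s))))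

  private
    step wrap : (ℕ → Bool) → ℕ × ℕ → ℚ
    step g (p , q) = 𝟙 (separates g (p , q) ∧ does (∣ p - q ∣ ℕ.≟ 1))
    wrap g (p , q) = 𝟙 (separates g (p , q) ∧ does (∣ p - q ∣ ℕ.≟ r))

    crossSum-split : ∀ g → crossSum g cycleMultiplicity ≡ ∑[ s < M ] step g (ends s) + ∑[ s < M ] wrap g (ends s)
    crossSum-split g =
      trans (sum-cong-≗ (λ s → multiplicity-split (separates g (ends s)) (proj₁ (ends s)) (proj₂ (ends s))))
                             (∑-distrib-+ (step g ∘ ends) (wrap g ∘ ends))

    ≢⇒xor : ∀ {x y} → x ≢ y → x xor y ≡ true
    ≢⇒xor {false} {false} x≢y = contradiction refl x≢y
    ≢⇒xor {false} {true}  _   = refl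
    ≢⇒xor {true}  {false} _   = refl
    ≢⇒xor {true}  {true}  x≢y = contradiction refl x≢y

    step-at-change : ∀ g {k} → g k ≢ g (suc k) → step g (k , suc k) ≡ 1ℚ
    step-at-change g {k} change =
      cong 𝟙 (cong₂ _∧_ (≢⇒xor change) (dec-true (∣ k - suc k ∣ ℕ.≟ 1) (∣n-1+n∣≡1 k)))

    wrap-at-change : ∀ g → g 0 ≢ g r → wrap g (0 , r) ≡ 1ℚ
    wrap-at-change g change = cong 𝟙 (cong₂ _∧_ (≢⇒xor change) (dec-true (r ℕ.≟ r) refl))

    index-of-step : ∀ {k} → k ℕ.< r → ∃[ s ] ends s ≡ (k , suc k)
    index-of-step k<r = ends-surjective (ℕ.n<1+n _) (s≤s k<r)

  crossSum-cut≥2 : ∀ {g} → (∃[ m ] m ℕ.≤ r × g m ≢ g 0) → 1ℚ + 1ℚ ≤ crossSum g cycleMultiplicity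
  crossSum-cut≥2 {g} (m , m≤r , gm≢g0) with g 0 ≟ᴮ g r
  ... | no g0≢gr with change-between g z≤n g0≢gr
  ...   | k , _ , k<r , change with index-of-step k<r | ends-surjective (ℕ.≤-<-trans z≤n k<r) (ℕ.n<1+n r)
  ...     | s₁ , ends≡₁ | s₂ , ends≡₂ = begin
    1ℚ + 1ℚ
      ≡⟨ cong₂ _+_ (trans (cong (step g) ends≡₁) (step-at-change g change))
                   (trans (cong (wrap g) ends≡₂) (wrap-at-change g g0≢gr)) ⟨
    step g (ends s₁) + wrap g (ends s₂)
      ≤⟨ +-mono-≤ (term≤∑ {f = step g ∘ ends} (λ s → 0≤𝟙 _) s₁)
                  (term≤∑ {f = wrap g ∘ ends} (λ s → 0≤𝟙 _) s₂) ⟩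
    ∑[ s < M ] step g (ends s) + ∑[ s < M ] wrap g (ends s)
      ≡⟨ crossSum-split g ⟨
    crossSum g cycleMultiplicity ∎
    where open ≤-Reasoning
  crossSum-cut≥2 {g} (m , m≤r , gm≢g0) | yes g0≡gr
    with change-between g z≤n (gm≢g0 ∘ sym)
       | change-between g m≤r (λ gm≡gr → gm≢g0 (trans gm≡gr (sym g0≡gr)))
  ... | k₁ , _ , k₁<m , change₁ | k₂ , m≤k₂ , k₂<r , change₂
    with index-of-step (ℕ.<-≤-trans k₁<m m≤r) | index-of-step k₂<r
  ... | s₁ , ends≡₁ | s₂ , ends≡₂ = begin
    1ℚ + 1ℚ
      ≡⟨ cong₂ _+_ (trans (cong (step g) ends≡₁) (step-at-change g change₁))
                   (trans (cong (step g) ends≡₂) (step-at-change g change₂)) ⟨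
    step g (ends s₁) + step g (ends s₂)
      ≤⟨ two-terms≤∑ {f = step g ∘ ends} (λ s → 0≤𝟙 _) s₁≢s₂ ⟩
    ∑[ s < M ] step g (ends s)
      ≤⟨ p≤p+q (0≤∑ {f = wrap g ∘ ends} (λ s → 0≤𝟙 _)) ⟩
    ∑[ s < M ] step g (ends s) + ∑[ s < M ] wrap g (ends s)
      ≡⟨ crossSum-split g ⟨
    crossSum g cycleMultiplicity ∎
    where
    open ≤-Reasoning
    s₁≢s₂ : s₁ ≢ s₂
    s₁≢s₂ refl = ℕ.<-irrefl (cong proj₁ (trans (sym ends≡₁) ends≡₂)) (ℕ.<-≤-trans k₁<m m≤k₂)

  cut-colour-change : ∀ {Y} → IsCut Y → ∃[ m ] m ℕ.≤ r × at Y m ≢ at Y 0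
  cut-colour-change {Y} ((i , i∈Y) , (j , j∈∁Y)) with at Y 0 ≟ᴮ true
  ... | yes Y₀ = toℕ j , s≤s⁻¹ (toℕ<n j) ,
                 λ Yⱼ≡Y₀ → contradiction (trans (sym j-outside) (trans Yⱼ≡Y₀ Y₀)) λ ()
    where
    j-outside : at Y (toℕ j) ≡ false
    j-outside = trans (sym (lookup-at Y j)) (not-true (trans (sym (lookup-map j not Y)) ([]=⇒lookup j∈∁Y)))
      where
      not-true : ∀ {x} → not x ≡ true → x ≡ false
      not-true {false} _ = refl
  ... | no ¬Y₀ = toℕ i , s≤s⁻¹ (toℕ<n i) ,
                 λ Yᵢ≡Y₀ → ¬Y₀ (trans (sym Yᵢ≡Y₀) (trans (sym (lookup-at Y i)) ([]=⇒lookup i∈Y)))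

  near-mincut-bound : ∀ {x y x′ y′} → x ≤ 1ℚ + 1ℚ → y ≤ D → 1ℚ + 1ℚ ≤ x′ → 0ℚ ≤ y′ →
    D * x + δ * y ≤ (1ℚ + δ) * (D * x′ + δ * y′)
  near-mincut-bound {x} {y} {x′} {y′} x≤2 y≤D 2≤x′ 0≤y′ = begin
    D * x + δ * y                          ≤⟨ +-mono-≤ (*-monoˡ-≤-nonNeg D x≤2) (*-monoˡ-≤-nonNeg δ y≤D) ⟩
    D * (1ℚ + 1ℚ) + δ * D                  ≤⟨ p≤p+q (0≤p*q 0≤δ 0≤D) ⟩
    D * (1ℚ + 1ℚ) + δ * D + δ * D          ≡⟨ regroup D δ ⟩
    (1ℚ + δ) * (D * (1ℚ + 1ℚ))             ≤⟨ *-monoˡ-≤-nonNeg (1ℚ + δ) 2D≤cut ⟩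
    (1ℚ + δ) * (D * x′ + δ * y′)           ∎
    where
    open ≤-Reasoning
    0≤δ : 0ℚ ≤ δ
    0≤δ = <⇒≤ 0<δ
    instance
      D-nonNeg : NonNegative D
      D-nonNeg = nonNegative 0≤D
      δ-nonNeg : NonNegative δ
      δ-nonNeg = nonNegative 0≤δ
      1+δ-nonNeg : NonNegative (1ℚ + δ)
      1+δ-nonNeg = nonNegative (≤-trans (nonNegative⁻¹ 1ℚ) (p≤p+q 0≤δ))
    regroup : ∀ d e → d * (1ℚ + 1ℚ) + e * d + e * d ≡ (1ℚ + e) * (d * (1ℚ + 1ℚ))
    regroup = solve 2 (λ d e → d :* (con 1ℚ :+ con 1ℚ) :+ e :* d :+ e :* d
                            := (con 1ℚ :+ e) :* (d :* (con 1ℚ :+ con 1ℚ))) refl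
    2D≤cut : D * (1ℚ + 1ℚ) ≤ D * x′ + δ * y′
    2D≤cut = ≤-trans (*-monoˡ-≤-nonNeg D 2≤x′) (p≤p+q (0≤p*q 0≤δ 0≤y′))

  arc-nearMincut : ∀ {t} → ProperInterval r t → IsNearMincut weight (1ℚ + δ) (arc t)
  arc-nearMincut {t} proper = arc-isCut proper , λ Y Y-cut →
    subst₂ _≤_ (sym (cutWeight≡crossSums (arc t) (_∈ᴵ t) (crosses-arc t)))
               (cong ((1ℚ + δ) *_) (sym (cutWeight≡crossSums Y (at Y) (crosses-at Y))))
               (near-mincut-bound (crossSum-arc≤2 proper) (crossSum-ones≤D (_∈ᴵ t))
                                  (crossSum-cut≥2 (cut-colour-change Y-cut)) (0≤crossSum-ones (at Y)))

  arcs : Vec (Subset (suc r)) M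
  arcs = tabulate (arc ∘ ends)

  arcs-independent : LinIndep (Vec.map (χ weight) arcs)
  arcs-independent c combination-zero =
    interval-crossings-independent ends ends-injective ends-proper (lookup c) balanced
    where
    balanced : ∀ {p q} → p ℕ.< q → q ℕ.≤ r →
      ∑[ i < M ] (lookup c i * 𝟙 (p ∈ᴵ ends i xor q ∈ᴵ ends i)) ≡ 0ℚ
    balanced {p} {q} p<q q≤r with ends-surjective p<q (s≤s q≤r)
    ... | s₀ , ends≡ = trans (sum-cong-≗ (λ i → cong (λ x → lookup c i * 𝟙 x) (sym (crossing i))))
                             (relation-at-edge weight arcs c combination-zero e∈E)
      where
      e∈E : pair s₀ ∈ edges weight
      e∈E = ∈-filter⁺ positive? (∈-lookup {xs = allPairs (suc r)} s₀)
                      (weight-positive (proj₁ (pair s₀)) (proj₂ (pair s₀)))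
      crossing : ∀ i → crosses (lookup arcs i) (pair s₀) ≡ separates (_∈ᴵ ends i) (p , q)
      crossing i = trans (cong (λ X → crosses X (pair s₀)) (lookup∘tabulate (arc ∘ ends) i))
                         (trans (crosses-arc (ends i) (pair s₀)) (cong (separates (_∈ᴵ ends i)) ends≡))

  arcs-cdim : HasCdim weight (1ℚ + δ) M
  arcs-cdim = (arcs , arcs-nearMincut , arcs-independent) ,
              λ k Ys _ independent → ℕ.≤-trans (LinIndep⇒≤ _ independent) (length-filter positive? (allPairs (suc r)))
    where
    arcs-nearMincut : ∀ i → IsNearMincut weight (1ℚ + δ) (lookup arcs i)
    arcs-nearMincut i = subst (IsNearMincut weight (1ℚ + δ)) (sym (lookup∘tabulate (arc ∘ ends) i))
                              (arc-nearMincut (ends-proper i))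

open import Data.Nat using (ℕ; zero; suc; _≤_)
open import Data.Nat.Combinatorics using (_C_)
open import Data.Product using (Σ; _×_; _,_)
open import Data.Rational using (ℚ; 0ℚ; 1ℚ; _+_; _-_; -_; _<_)
open import Data.Rational.Properties using (+-monoˡ-<)
open import Relation.Binary.PropositionalEquality using (_≡_; refl; subst₂)
open +-*-Solver using (solve; _:+_; _:-_; _:=_; con)

-- The hypothesis 2 ≤ n only excludes n = 0; for n = 1 there are no pairs and the construction still applies.
theorem8p4 : (n : ℕ) → 2 ≤ n → (α : ℚ) → 1ℚ < α →
    Σ (Weight n) (λ w → IsWeighting w × HasCdim w α (n C 2))
theorem8p4 zero    ()
theorem8p4 (suc r) _ α 1<α =
  weight , weight-isWeighting , subst₂ (HasCdim weight) 1+δ≡α (Pairs.length-allPairs (suc r)) arcs-cdim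
  where
  δ : ℚ
  δ = α - 1ℚ
  0<δ : 0ℚ < δ
  0<δ = +-monoˡ-< (- 1ℚ) 1<α
  open CycleGraph r δ 0<δ
  1+δ≡α : 1ℚ + δ ≡ α
  1+δ≡α = solve 1 (λ a → con 1ℚ :+ (a :- con 1ℚ) := a) refl α
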